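{- In the probabilistic call-by-value calculus $(\mathcal M(\Lambda_\oplus),\{\Rrightarrow_{\beta_v},\Rrightarrow_\oplus\})$, let $\Rrightarrow_{\mathsf w}:=\Rrightarrow_{\mathsf w\beta_v}\cup\Rrightarrow_\oplus$ and $\Rrightarrow_{\neg\mathsf w}:=\Rrightarrow_{\neg\mathsf w\beta_v}$. Then weak factorization holds: $(\Rrightarrow_{\beta_v}\cup\Rrightarrow_\oplus)^*\subseteq\Rrightarrow_{\mathsf w}^*\cdot\Rrightarrow_{\neg\mathsf w}^*$.
   Context: Terms: $M::=x\mid\lambda x.M\mid MM\mid M\oplus M$ (modulo $\alpha$-equivalence); values $V::=x\mid\lambda x.M$. Contexts $C::=\langle\cdot\rangle\mid CM\mid MC\mid\lambda x.C\mid C\oplus M\mid M\oplus C$; weak contexts $S::=\langle\cdot\rangle\mid SM\mid MS$. A multi-distribution is a finite multiset $[p_iM_i\mid i\in I]$ of pairs with $p_i\in(0,1]$, $M_i$ terms, $\sum_ip_i\le1$; $\mathcal M(\Lambda_\oplus)$ is the set of multi-distributions, $+$ is multiset sum, $q\cdot[p_iM_i]_{i}:=[(qp_i)M_i]_i$, and $[M]$ means $[1M]$. Term-to-multi-distribution steps: $C\langle(\lambda x.M)V\rangle\to_{\beta_v}[C\langle M\{x:=V\}\rangle]$ for any context $C$; $S\langle M\oplus N\rangle\to_\oplus[\tfrac12 S\langle M\rangle,\tfrac12 S\langle N\rangle]$ for weak contexts $S$ only. $\to_{\mathsf w\beta_v}$ is the restriction of $\to_{\beta_v}$ to weak contexts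 $C$, and $\to_{\neg\mathsf w\beta_v}$ its restriction to contexts $C$ that are not weak. Lifting of a relation $\to_r\subseteq\Lambda_\oplus\times\mathcal M(\Lambda_\oplus)$ to $\Rrightarrow_r\subseteq\mathcal M(\Lambda_\oplus)\times\mathcal M(\Lambda_\oplus)$ is inductively defined by: $[M]\Rrightarrow_r[M]$; $[M]\Rrightarrow_r\mathtt m$ if $M\to_r\mathtt m$; and $[p_iM_i\mid i\in I]\Rrightarrow_r\sum_{i\in I}p_i\cdot\mathtt m_i$ if $[M_i]\Rrightarrow_r\mathtt m_i$ for each $i\in I$. $\Rrightarrow_{\beta_v},\Rrightarrow_\oplus,\Rrightarrow_{\mathsf w\beta_v},\Rrightarrow_{\neg\mathsf w\beta_v}$ are the liftings of $\to_{\beta_v},\to_\oplus,\to_{\mathsf w\beta_v},\to_{\neg\mathsf w\beta_v}$. $^*$ is reflexive-transitive closure, $\cdot$ composition.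
   Formalization: The probabilities $p_i$ of multi-distributions are rational numbers in (0,1]. -}

module Defs where

open import Data.Nat as ℕ using (ℕ; zero; suc)
open import Data.Bool using (Bool; true; false)
open import Data.Rational as ℚ using (ℚ; 0ℚ; 1ℚ; ½)
open import Data.Product using (Σ; _×_; _,_; proj₁; proj₂; ∃-syntax)
open import Data.List using (List; []; _∷_; [_]; _++_; map; foldr)
open import Data.List.Relation.Unary.All using (All)
open import Data.List.Relation.Binary.Permutation.Propositional using (_↭_)
open import Relation.Nullary using (¬_)
open import Relation.Binary.Construct.Union using (_∪_)
open import Relation.Binary.Construct.Closure.ReflexiveTransitive using (Star)

-- Terms of Λ⊕, modulo α-equivalence: (unscoped) de Bruijn indices.

infixl 7 _·_
infixl 6 _⊕_

data Tm : Set where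
  var : ℕ → Tm
  lam : Tm → Tm
  _·_ : Tm → Tm → Tm
  _⊕_ : Tm → Tm → Tm

data Value : Tm → Set where
  var : ∀ x → Value (var x)
  lam : ∀ M → Value (lam M)

shift : ℕ → Tm → Tm
shift c (var x) with c ℕ.≤ᵇ x
... | true  = var (suc x)
... | false = var x
shift c (lam M) = lam (shift (suc c) M)
shift c (M · N) = shift c M · shift c N
shift c (M ⊕ N) = shift c M ⊕ shift c N

-- subst j V M : capture-avoiding substitution of V for index j in M,
-- the binder of j being removed (indices above j are decremented).
subst : ℕ → Tm → Tm → Tm
subst j V (var x) with ℕ.compare x j
... | ℕ.less _ _    = var x
... | ℕ.equal _     = V
... | ℕ.greater _ k = var (x ℕ.∸ 1)
subst j V (lam M) = lam (subst (suc j) (shift 0 V) M)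
subst j V (M · N) = subst j V M · subst j V N
subst j V (M ⊕ N) = subst j V M ⊕ subst j V N

-- M{x:=V} where x is the variable bound by the enclosing λ
_[0≔_] : Tm → Tm → Tm
M [0≔ V ] = subst 0 V M

data Ctx : Set where
  hole : Ctx
  appL : Ctx → Tm → Ctx
  appR : Tm → Ctx → Ctx
  lamC : Ctx → Ctx
  orL  : Ctx → Tm → Ctx
  orR  : Tm → Ctx → Ctx

plug : Ctx → Tm → Tm
plug hole       P = P
plug (appL C M) P = plug C P · M
plug (appR M C) P = M · plug C P
plug (lamC C)   P = lam (plug C P)
plug (orL C M)  P = plug C P ⊕ M
plug (orR M C)  P = M ⊕ plug C P

data Weak : Ctx → Set where
  hole : Weak hole
  appL : ∀ {C} M → Weak C → Weak (appL C M)
  appR : ∀ {C} M → Weak C → Weak (appR M C)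

-- Multi-distributions: finite multisets [p_i M_i] represented as lists
-- (multiset equality is permutation _↭_, see the lifting below).

MList : Set
MList = List (ℚ × Tm)

sumℚ : List ℚ → ℚ
sumℚ = foldr ℚ._+_ 0ℚ

IsMD : MList → Set
IsMD ms = All (λ pM → (0ℚ ℚ.< proj₁ pM) × (proj₁ pM ℚ.≤ 1ℚ)) ms
        × (sumℚ (map proj₁ ms) ℚ.≤ 1ℚ)

MD : Set
MD = Σ MList IsMD

_∙_ : ℚ → MList → MList
q ∙ ms = map (λ pM → (q ℚ.* proj₁ pM , proj₂ pM)) ms

⟦_⟧ : Tm → MList
⟦ M ⟧ = [ (1ℚ , M) ]

StepRel : Set₁
StepRel = Tm → MList → Set

data _→βv_ : StepRel where
  βv : ∀ C M V → Value V → plug C (lam M · V) →βv ⟦ plug C (M [0≔ V ]) ⟧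

data _→⊕_ : StepRel where
  ⊕s : ∀ S → Weak S → ∀ M N →
       plug S (M ⊕ N) →⊕ ((½ , plug S M) ∷ (½ , plug S N) ∷ [])

data _→wβv_ : StepRel where
  wβv : ∀ C → Weak C → ∀ M V → Value V → plug C (lam M · V) →wβv ⟦ plug C (M [0≔ V ]) ⟧

data _→¬wβv_ : StepRel where
  ¬wβv : ∀ C → ¬ Weak C → ∀ M V → Value V → plug C (lam M · V) →¬wβv ⟦ plug C (M [0≔ V ]) ⟧

mutual
  data LiftL (r : StepRel) : MList → MList → Set where
    lrefl : ∀ M → LiftL r ⟦ M ⟧ ⟦ M ⟧
    lstep : ∀ {M m} → r M m → LiftL r ⟦ M ⟧ m
    lsum  : ∀ {ms ns} → LiftAll r ms ns → LiftL r ms ns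

  data LiftAll (r : StepRel) : MList → MList → Set where
    []  : LiftAll r [] []
    _∷_ : ∀ {p M m ms ns} → LiftL r ⟦ M ⟧ m → LiftAll r ms ns →
          LiftAll r ((p , M) ∷ ms) ((p ∙ m) ++ ns)

-- The lifted relation ⇛_r on multi-distributions (multisets: the target
-- is taken up to permutation; LiftL is itself permutation-invariant in
-- its source).
Lift : StepRel → MD → MD → Set
Lift r m n = ∃[ n' ] (LiftL r (proj₁ m) n' × (n' ↭ proj₁ n))

⇛βv ⇛⊕ ⇛wβv ⇛¬wβv ⇛w ⇛¬w : MD → MD → Set
⇛βv   = Lift _→βv_
⇛⊕    = Lift _→⊕_
⇛wβv  = Lift _→wβv_
⇛¬wβv = Lift _→¬wβv_
⇛w    = ⇛wβv ∪ ⇛⊕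
⇛¬w   = ⇛¬wβv

module Submission where

-- The proof uses Takahashi's parallel-reduction method.  After the de Bruijn
-- substitution lemmas we introduce parallel reduction ⇉ and its internal
-- part ⇉ᵢ (nothing contracted in weak position) and show that a parallel
-- step is weak steps followed by an internal one.  This yields postponement
-- on terms: an internal step followed by a weak βv or ⊕ step becomes weak
-- steps followed by an internal step.  Multi-distributions are then handled
-- as lists with a pointwise normal form of the lifting: postponement lifts
-- to lists, a lifted βv step splits into a weak and an internal step, and
-- internal steps are non-weak βv steps.

open import Defs
open import Algebra.Bundles using (CommutativeMonoid)
open import Data.Bool using (true; false)
open import Data.List using ([]; _∷_; _++_; map)
open import Data.List.Properties using (map-++; ++-identityʳ; ++-assoc)
open import Data.List.Relation.Binary.Pointwise using (Pointwise; []; _∷_)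
import Data.List.Relation.Binary.Pointwise as PW
open import Data.List.Relation.Binary.Permutation.Propositional
  using (_↭_; ↭-refl; ↭-sym; ↭-trans; ↭-reflexive; ↭⇒↭ₛ)
import Data.List.Relation.Binary.Permutation.Propositional as ↭
open import Data.List.Relation.Binary.Permutation.Propositional.Properties
  using (++⁺ˡ; ++⁺; shifts; map⁺; All-resp-↭)
open import Data.List.Relation.Binary.Permutation.Setoid.Properties using (foldr-commMonoid)
open import Data.List.Relation.Unary.All using (All; []; _∷_)
open import Data.List.Relation.Unary.All.Properties using () renaming (++⁺ to ++⁺ᴬ)
open import Data.Nat as ℕ using (suc; _≤_; _<_; z≤n; s≤s; _∸_)
open import Data.Nat.Properties
  using (≤⇒≤ᵇ; ≤ᵇ⇒≤; <⇒≱; <⇒≤; <-irrefl; m≤m+n; _<?_; ≮⇒≥; <-cmp; ≤-trans; ≤-pred;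
         <-≤-trans; ≤-<-trans; m<n⇒m<1+n; m≤n⇒m≤1+n)
open import Data.Product using (_×_; _,_; proj₁; proj₂; ∃-syntax)
open import Data.Rational as ℚ using (ℚ; 0ℚ; 1ℚ; ½)
import Data.Rational.Properties as ℚ
open import Data.Sum using (_⊎_; inj₁; inj₂; [_,_]′)
import Data.Sum as Sum
open import Function using (_∘_; id)
open import Relation.Binary using (tri<; tri≈; tri>)
open import Relation.Binary.Construct.Closure.ReflexiveTransitive using (Star; ε; _◅_; _◅◅_; gmap; _⋆)
open import Relation.Binary.Construct.Union using (_∪_)
open import Relation.Binary.PropositionalEquality
  using (_≡_; refl; sym; trans; cong; cong₂; module ≡-Reasoning)
  renaming (subst to ≡-subst; subst₂ to ≡-subst₂)
open import Relation.Nullary using (¬_; Dec; yes; no; contradiction)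
open import Relation.Nullary.Decidable using (map′; toWitness)

open ≡-Reasoning

shift-var-< : ∀ {c x} → x < c → shift c (var x) ≡ var x
shift-var-< {c} {x} x<c with c ℕ.≤ᵇ x | ≤ᵇ⇒≤ c x
... | true  | c≤x = contradiction (c≤x _) (<⇒≱ x<c)
... | false | _   = refl

shift-var-≥ : ∀ {c x} → c ≤ x → shift c (var x) ≡ var (suc x)
shift-var-≥ {c} {x} c≤x with c ℕ.≤ᵇ x | ≤⇒≤ᵇ c≤x
... | true | _ = refl

subst-var-< : ∀ {j V x} → x < j → subst j V (var x) ≡ var x
subst-var-< {j} {V} {x} x<j with ℕ.compare x j
... | ℕ.less _ _    = refl
... | ℕ.equal _     = contradiction x<j (<-irrefl refl)
... | ℕ.greater _ k = contradiction x<j (<⇒≱ (s≤s (m≤m+n j k)) ∘ <⇒≤)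

subst-var-≡ : ∀ {j V x} → x ≡ j → subst j V (var x) ≡ V
subst-var-≡ {j} {V} {x} x≡j with ℕ.compare x j
... | ℕ.less _ k    = contradiction (s≤s (m≤m+n x k)) (<-irrefl x≡j)
... | ℕ.equal _     = refl
... | ℕ.greater _ k = contradiction (s≤s (m≤m+n j k)) (<-irrefl (sym x≡j))

subst-var-> : ∀ {j V x} → j < x → subst j V (var x) ≡ var (x ∸ 1)
subst-var-> {j} {V} {x} j<x with ℕ.compare x j
... | ℕ.less _ k    = contradiction j<x (<⇒≱ (s≤s (m≤m+n x k)) ∘ <⇒≤)
... | ℕ.equal _     = contradiction j<x (<-irrefl refl)
... | ℕ.greater _ _ = refl

shift-shift-var : ∀ {c i} x → c ≤ i → shift (suc i) (shift c (var x)) ≡ shift c (shift i (var x))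
shift-shift-var {c} {i} x c≤i with x <? c | x <? i
... | yes x<c | _ = begin
  shift (suc i) (shift c (var x)) ≡⟨ cong (shift (suc i)) (shift-var-< x<c) ⟩
  shift (suc i) (var x)           ≡⟨ shift-var-< (m<n⇒m<1+n x<i) ⟩
  var x                           ≡⟨ shift-var-< x<c ⟨
  shift c (var x)                 ≡⟨ cong (shift c) (shift-var-< x<i) ⟨
  shift c (shift i (var x))       ∎
  where x<i = <-≤-trans x<c c≤i
... | no x≮c | yes x<i = begin
  shift (suc i) (shift c (var x)) ≡⟨ cong (shift (suc i)) (shift-var-≥ (≮⇒≥ x≮c)) ⟩
  shift (suc i) (var (suc x))     ≡⟨ shift-var-< (s≤s x<i) ⟩
  var (suc x)                     ≡⟨ shift-var-≥ (≮⇒≥ x≮c) ⟨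
  shift c (var x)                 ≡⟨ cong (shift c) (shift-var-< x<i) ⟨
  shift c (shift i (var x))       ∎
... | no x≮c | no x≮i = begin
  shift (suc i) (shift c (var x)) ≡⟨ cong (shift (suc i)) (shift-var-≥ (≮⇒≥ x≮c)) ⟩
  shift (suc i) (var (suc x))     ≡⟨ shift-var-≥ (s≤s (≮⇒≥ x≮i)) ⟩
  var (suc (suc x))               ≡⟨ shift-var-≥ (m≤n⇒m≤1+n (≮⇒≥ x≮c)) ⟨
  shift c (var (suc x))           ≡⟨ cong (shift c) (shift-var-≥ (≮⇒≥ x≮i)) ⟨
  shift c (shift i (var x))       ∎

shift-shift : ∀ c i U → c ≤ i → shift (suc i) (shift c U) ≡ shift c (shift i U)
shift-shift c i (var x) c≤i = shift-shift-var x c≤i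
shift-shift c i (lam U) c≤i = cong lam (shift-shift (suc c) (suc i) U (s≤s c≤i))
shift-shift c i (U · W) c≤i = cong₂ _·_ (shift-shift c i U c≤i) (shift-shift c i W c≤i)
shift-shift c i (U ⊕ W) c≤i = cong₂ _⊕_ (shift-shift c i U c≤i) (shift-shift c i W c≤i)

subst-shift : ∀ i W U → subst i W (shift i U) ≡ U
subst-shift i W (var x) with x <? i
... | yes x<i = trans (cong (subst i W) (shift-var-< x<i)) (subst-var-< x<i)
... | no x≮i  = trans (cong (subst i W) (shift-var-≥ (≮⇒≥ x≮i))) (subst-var-> (s≤s (≮⇒≥ x≮i)))
subst-shift i W (lam U) = cong lam (subst-shift (suc i) (shift 0 W) U)
subst-shift i W (U · V) = cong₂ _·_ (subst-shift i W U) (subst-shift i W V)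
subst-shift i W (U ⊕ V) = cong₂ _⊕_ (subst-shift i W U) (subst-shift i W V)

shift-subst-below-var : ∀ {c j} U x → c ≤ j →
  shift c (subst j U (var x)) ≡ subst (suc j) (shift c U) (shift c (var x))
shift-subst-below-var {c} {j} U x c≤j with <-cmp x j
... | tri< x<j _ _ with x <? c
...   | yes x<c = begin
  shift c (subst j U (var x))                   ≡⟨ cong (shift c) (subst-var-< x<j) ⟩
  shift c (var x)                               ≡⟨ shift-var-< x<c ⟩
  var x                                         ≡⟨ subst-var-< (m<n⇒m<1+n x<j) ⟨
  subst (suc j) (shift c U) (var x)             ≡⟨ cong (subst (suc j) (shift c U)) (shift-var-< x<c) ⟨
  subst (suc j) (shift c U) (shift c (var x))   ∎
...   | no x≮c = begin
  shift c (subst j U (var x))                   ≡⟨ cong (shift c) (subst-var-< x<j) ⟩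
  shift c (var x)                               ≡⟨ shift-var-≥ (≮⇒≥ x≮c) ⟩
  var (suc x)                                   ≡⟨ subst-var-< (s≤s x<j) ⟨
  subst (suc j) (shift c U) (var (suc x))       ≡⟨ cong (subst (suc j) (shift c U)) (shift-var-≥ (≮⇒≥ x≮c)) ⟨
  subst (suc j) (shift c U) (shift c (var x))   ∎
shift-subst-below-var {c} {j} U x c≤j | tri≈ _ refl _ = begin
  shift c (subst x U (var x))                   ≡⟨ cong (shift c) (subst-var-≡ {x} {U} refl) ⟩
  shift c U                                     ≡⟨ subst-var-≡ {suc x} {shift c U} refl ⟨
  subst (suc x) (shift c U) (var (suc x))       ≡⟨ cong (subst (suc x) (shift c U)) (shift-var-≥ c≤j) ⟨
  subst (suc x) (shift c U) (shift c (var x))   ∎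
shift-subst-below-var {c} {j} U (suc x) c≤j | tri> _ _ j<x = begin
  shift c (subst j U (var (suc x)))             ≡⟨ cong (shift c) (subst-var-> j<x) ⟩
  shift c (var x)                               ≡⟨ shift-var-≥ c≤x ⟩
  var (suc x)                                   ≡⟨ subst-var-> (s≤s j<x) ⟨
  subst (suc j) (shift c U) (var (suc (suc x))) ≡⟨ cong (subst (suc j) (shift c U)) (shift-var-≥ (m≤n⇒m≤1+n c≤x)) ⟨
  subst (suc j) (shift c U) (shift c (var (suc x))) ∎
  where c≤x = ≤-trans c≤j (≤-pred j<x)

shift-subst-below : ∀ c j U M → c ≤ j → shift c (subst j U M) ≡ subst (suc j) (shift c U) (shift c M)
shift-subst-below c j U (var x) c≤j = shift-subst-below-var U x c≤j
shift-subst-below c j U (lam M) c≤j = cong lam (begin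
  shift (suc c) (subst (suc j) (shift 0 U) M)
    ≡⟨ shift-subst-below (suc c) (suc j) (shift 0 U) M (s≤s c≤j) ⟩
  subst (suc (suc j)) (shift (suc c) (shift 0 U)) (shift (suc c) M)
    ≡⟨ cong (λ T → subst (suc (suc j)) T (shift (suc c) M)) (shift-shift 0 c U z≤n) ⟩
  subst (suc (suc j)) (shift 0 (shift c U)) (shift (suc c) M) ∎)
shift-subst-below c j U (M · N) c≤j = cong₂ _·_ (shift-subst-below c j U M c≤j) (shift-subst-below c j U N c≤j)
shift-subst-below c j U (M ⊕ N) c≤j = cong₂ _⊕_ (shift-subst-below c j U M c≤j) (shift-subst-below c j U N c≤j)

shift-subst-above-var : ∀ {c j} U x → j ≤ c →
  shift c (subst j U (var x)) ≡ subst j (shift c U) (shift (suc c) (var x))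
shift-subst-above-var {c} {j} U x j≤c with <-cmp x j
... | tri< x<j _ _ = begin
  shift c (subst j U (var x))                     ≡⟨ cong (shift c) (subst-var-< x<j) ⟩
  shift c (var x)                                 ≡⟨ shift-var-< (<-≤-trans x<j j≤c) ⟩
  var x                                           ≡⟨ subst-var-< x<j ⟨
  subst j (shift c U) (var x)                     ≡⟨ cong (subst j (shift c U)) (shift-var-< (m<n⇒m<1+n (<-≤-trans x<j j≤c))) ⟨
  subst j (shift c U) (shift (suc c) (var x))     ∎
... | tri≈ _ refl _ = begin
  shift c (subst x U (var x))                     ≡⟨ cong (shift c) (subst-var-≡ {x} {U} refl) ⟩
  shift c U                                       ≡⟨ subst-var-≡ {x} {shift c U} refl ⟨
  subst x (shift c U) (var x)                     ≡⟨ cong (subst x (shift c U)) (shift-var-< (s≤s j≤c)) ⟨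
  subst x (shift c U) (shift (suc c) (var x))     ∎
shift-subst-above-var {c} {j} U (suc x) j≤c | tri> _ _ j<x with x <? c
... | yes x<c = begin
  shift c (subst j U (var (suc x)))               ≡⟨ cong (shift c) (subst-var-> j<x) ⟩
  shift c (var x)                                 ≡⟨ shift-var-< x<c ⟩
  var x                                           ≡⟨ subst-var-> j<x ⟨
  subst j (shift c U) (var (suc x))               ≡⟨ cong (subst j (shift c U)) (shift-var-< (s≤s x<c)) ⟨
  subst j (shift c U) (shift (suc c) (var (suc x))) ∎
... | no x≮c = begin
  shift c (subst j U (var (suc x)))               ≡⟨ cong (shift c) (subst-var-> j<x) ⟩
  shift c (var x)                                 ≡⟨ shift-var-≥ (≮⇒≥ x≮c) ⟩
  var (suc x)                                     ≡⟨ subst-var-> (m<n⇒m<1+n j<x) ⟨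
  subst j (shift c U) (var (suc (suc x)))         ≡⟨ cong (subst j (shift c U)) (shift-var-≥ (s≤s (≮⇒≥ x≮c))) ⟨
  subst j (shift c U) (shift (suc c) (var (suc x))) ∎

shift-subst-above : ∀ c j U M → j ≤ c → shift c (subst j U M) ≡ subst j (shift c U) (shift (suc c) M)
shift-subst-above c j U (var x) j≤c = shift-subst-above-var U x j≤c
shift-subst-above c j U (lam M) j≤c = cong lam (begin
  shift (suc c) (subst (suc j) (shift 0 U) M)
    ≡⟨ shift-subst-above (suc c) (suc j) (shift 0 U) M (s≤s j≤c) ⟩
  subst (suc j) (shift (suc c) (shift 0 U)) (shift (suc (suc c)) M)
    ≡⟨ cong (λ T → subst (suc j) T (shift (suc (suc c)) M)) (shift-shift 0 c U z≤n) ⟩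
  subst (suc j) (shift 0 (shift c U)) (shift (suc (suc c)) M) ∎)
shift-subst-above c j U (M · N) j≤c = cong₂ _·_ (shift-subst-above c j U M j≤c) (shift-subst-above c j U N j≤c)
shift-subst-above c j U (M ⊕ N) j≤c = cong₂ _⊕_ (shift-subst-above c j U M j≤c) (shift-subst-above c j U N j≤c)

subst-subst-var : ∀ {i j} W U x → i ≤ j →
  subst j U (subst i W (var x)) ≡ subst i (subst j U W) (subst (suc j) (shift i U) (var x))
subst-subst-var {i} {j} W U x i≤j with <-cmp x i
... | tri< x<i _ _ = begin
  subst j U (subst i W (var x))             ≡⟨ cong (subst j U) (subst-var-< x<i) ⟩
  subst j U (var x)                         ≡⟨ subst-var-< (<-≤-trans x<i i≤j) ⟩
  var x                                     ≡⟨ subst-var-< x<i ⟨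
  subst i (subst j U W) (var x)             ≡⟨ cong (subst i (subst j U W)) (subst-var-< (m<n⇒m<1+n (<-≤-trans x<i i≤j))) ⟨
  subst i (subst j U W) (subst (suc j) (shift i U) (var x)) ∎
... | tri≈ _ refl _ = begin
  subst j U (subst x W (var x))             ≡⟨ cong (subst j U) (subst-var-≡ {x} {W} refl) ⟩
  subst j U W                               ≡⟨ subst-var-≡ {x} {subst j U W} refl ⟨
  subst x (subst j U W) (var x)             ≡⟨ cong (subst x (subst j U W)) (subst-var-< (s≤s i≤j)) ⟨
  subst x (subst j U W) (subst (suc j) (shift x U) (var x)) ∎
subst-subst-var {i} {j} W U (suc x) i≤j | tri> _ _ i<x with <-cmp x j
... | tri< x<j _ _ = begin
  subst j U (subst i W (var (suc x)))       ≡⟨ cong (subst j U) (subst-var-> i<x) ⟩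
  subst j U (var x)                         ≡⟨ subst-var-< x<j ⟩
  var x                                     ≡⟨ subst-var-> i<x ⟨
  subst i (subst j U W) (var (suc x))       ≡⟨ cong (subst i (subst j U W)) (subst-var-< (s≤s x<j)) ⟨
  subst i (subst j U W) (subst (suc j) (shift i U) (var (suc x))) ∎
... | tri≈ _ refl _ = begin
  subst x U (subst i W (var (suc x)))       ≡⟨ cong (subst x U) (subst-var-> i<x) ⟩
  subst x U (var x)                         ≡⟨ subst-var-≡ {x} {U} refl ⟩
  U                                         ≡⟨ subst-shift i (subst x U W) U ⟨
  subst i (subst x U W) (shift i U)         ≡⟨ cong (subst i (subst x U W)) (subst-var-≡ {suc x} {shift i U} refl) ⟨
  subst i (subst x U W) (subst (suc x) (shift i U) (var (suc x))) ∎
subst-subst-var {i} {j} W U (suc (suc x)) i≤j | tri> _ _ i<x | tri> _ _ j<x = begin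
  subst j U (subst i W (var (suc (suc x)))) ≡⟨ cong (subst j U) (subst-var-> i<x) ⟩
  subst j U (var (suc x))                   ≡⟨ subst-var-> j<x ⟩
  var x                                     ≡⟨ subst-var-> (≤-<-trans i≤j j<x) ⟨
  subst i (subst j U W) (var (suc x))       ≡⟨ cong (subst i (subst j U W)) (subst-var-> (s≤s j<x)) ⟨
  subst i (subst j U W) (subst (suc j) (shift i U) (var (suc (suc x)))) ∎

subst-subst : ∀ i j W U M → i ≤ j →
  subst j U (subst i W M) ≡ subst i (subst j U W) (subst (suc j) (shift i U) M)
subst-subst i j W U (var x) i≤j = subst-subst-var W U x i≤j
subst-subst i j W U (lam M) i≤j = cong lam (begin
  subst (suc j) (shift 0 U) (subst (suc i) (shift 0 W) M)
    ≡⟨ subst-subst (suc i) (suc j) (shift 0 W) (shift 0 U) M (s≤s i≤j) ⟩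
  subst (suc i) (subst (suc j) (shift 0 U) (shift 0 W)) (subst (suc (suc j)) (shift (suc i) (shift 0 U)) M)
    ≡⟨ cong₂ (λ A B → subst (suc i) A (subst (suc (suc j)) B M))
             (sym (shift-subst-below 0 j U W z≤n)) (shift-shift 0 i U z≤n) ⟩
  subst (suc i) (shift 0 (subst j U W)) (subst (suc (suc j)) (shift 0 (shift i U)) M) ∎)
subst-subst i j W U (M · N) i≤j = cong₂ _·_ (subst-subst i j W U M i≤j) (subst-subst i j W U N i≤j)
subst-subst i j W U (M ⊕ N) i≤j = cong₂ _⊕_ (subst-subst i j W U M i≤j) (subst-subst i j W U N i≤j)

shift-β : ∀ c M W → shift c (M [0≔ W ]) ≡ (shift (suc c) M) [0≔ shift c W ]
shift-β c M W = shift-subst-above c 0 W M z≤n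

subst-β : ∀ j U M W → subst j U (M [0≔ W ]) ≡ (subst (suc j) (shift 0 U) M) [0≔ subst j U W ]
subst-β j U M W = subst-subst 0 j W U M z≤n

value-shift : ∀ c {V} → Value V → Value (shift c V)
value-shift c (var x) with c ℕ.≤ᵇ x
... | true  = var _
... | false = var _
value-shift c (lam M) = lam _

value-subst : ∀ j {U V} → Value U → Value V → Value (subst j U V)
value-subst j u (var x) with ℕ.compare x j
... | ℕ.less _ _    = var _
... | ℕ.equal _     = u
... | ℕ.greater _ _ = var _
value-subst j u (lam M) = lam _

-- Its internal part ⇉ᵢ leaves every redex in weak position alone: it only
-- reduces under a λ or a ⊕ reached through weak contexts.

infix 4 _⇉_ _⇉ᵢ_ _→w_

data _⇉_ : Tm → Tm → Set where
  pvar : ∀ x → var x ⇉ var x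
  plam : ∀ {M M'} → M ⇉ M' → lam M ⇉ lam M'
  papp : ∀ {M M' N N'} → M ⇉ M' → N ⇉ N' → M · N ⇉ M' · N'
  por  : ∀ {M M' N N'} → M ⇉ M' → N ⇉ N' → M ⊕ N ⇉ M' ⊕ N'
  pβ   : ∀ {M M' V V'} → Value V → M ⇉ M' → V ⇉ V' → lam M · V ⇉ M' [0≔ V' ]

data _⇉ᵢ_ : Tm → Tm → Set where
  ivar : ∀ x → var x ⇉ᵢ var x
  ilam : ∀ {M M'} → M ⇉ M' → lam M ⇉ᵢ lam M'
  iapp : ∀ {M M' N N'} → M ⇉ᵢ M' → N ⇉ᵢ N' → M · N ⇉ᵢ M' · N'
  ior  : ∀ {M M' N N'} → M ⇉ M' → N ⇉ N' → M ⊕ N ⇉ᵢ M' ⊕ N'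

data _→w_ : Tm → Tm → Set where
  wβ : ∀ {M V} → Value V → lam M · V →w M [0≔ V ]
  wL : ∀ {M M' N} → M →w M' → M · N →w M' · N
  wR : ∀ {M N N'} → N →w N' → M · N →w M · N'

⇉-refl : ∀ M → M ⇉ M
⇉-refl (var x) = pvar x
⇉-refl (lam M) = plam (⇉-refl M)
⇉-refl (M · N) = papp (⇉-refl M) (⇉-refl N)
⇉-refl (M ⊕ N) = por (⇉-refl M) (⇉-refl N)

⇉ᵢ-refl : ∀ M → M ⇉ᵢ M
⇉ᵢ-refl (var x) = ivar x
⇉ᵢ-refl (lam M) = ilam (⇉-refl M)
⇉ᵢ-refl (M · N) = iapp (⇉ᵢ-refl M) (⇉ᵢ-refl N)
⇉ᵢ-refl (M ⊕ N) = ior (⇉-refl M) (⇉-refl N)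

⇉ᵢ⇒⇉ : ∀ {M N} → M ⇉ᵢ N → M ⇉ N
⇉ᵢ⇒⇉ (ivar x)   = pvar x
⇉ᵢ⇒⇉ (ilam m)   = plam m
⇉ᵢ⇒⇉ (iapp m n) = papp (⇉ᵢ⇒⇉ m) (⇉ᵢ⇒⇉ n)
⇉ᵢ⇒⇉ (ior m n)  = por m n

-- Values reduce to values, and only internally; conversely an internal
-- reduct is a value only if the source is (this fails for ⇉: (λx.x)y ⇉ y).
value-⇉ : ∀ {V V'} → Value V → V ⇉ V' → Value V'
value-⇉ (var x) (pvar .x) = var x
value-⇉ (lam M) (plam _)  = lam _

value-⇉ᵢ : ∀ {V V'} → Value V → V ⇉ V' → V ⇉ᵢ V'
value-⇉ᵢ (var x) (pvar .x) = ivar x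
value-⇉ᵢ (lam M) (plam m)  = ilam m

value-⇉ᵢ⁻ : ∀ {V V'} → Value V' → V ⇉ᵢ V' → Value V
value-⇉ᵢ⁻ (var x) (ivar .x) = var x
value-⇉ᵢ⁻ (lam _) (ilam _)  = lam _

⇉-shift : ∀ c {M M'} → M ⇉ M' → shift c M ⇉ shift c M'
⇉-shift c (pvar x)   = ⇉-refl _
⇉-shift c (plam m)   = plam (⇉-shift (suc c) m)
⇉-shift c (papp m n) = papp (⇉-shift c m) (⇉-shift c n)
⇉-shift c (por m n)  = por (⇉-shift c m) (⇉-shift c n)
⇉-shift c (pβ {M' = M'} {V' = V'} v m u) =
  ≡-subst (_ ⇉_) (sym (shift-β c M' V'))
    (pβ (value-shift c v) (⇉-shift (suc c) m) (⇉-shift c u))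

⇉-subst : ∀ j {M M' U U'} → Value U → M ⇉ M' → U ⇉ U' → subst j U M ⇉ subst j U' M'
⇉-subst j u (pvar x) uu with ℕ.compare x j
... | ℕ.less _ _    = pvar _
... | ℕ.equal _     = uu
... | ℕ.greater _ _ = pvar _
⇉-subst j u (plam m)   uu = plam (⇉-subst (suc j) (value-shift 0 u) m (⇉-shift 0 uu))
⇉-subst j u (papp m n) uu = papp (⇉-subst j u m uu) (⇉-subst j u n uu)
⇉-subst j u (por m n)  uu = por (⇉-subst j u m uu) (⇉-subst j u n uu)
⇉-subst j {U' = U'} u (pβ {M' = M'} {V' = V'} v m w) uu =
  ≡-subst (_ ⇉_) (sym (subst-β j U' M' V'))
    (pβ (value-subst j u v) (⇉-subst (suc j) (value-shift 0 u) m (⇉-shift 0 uu)) (⇉-subst j u w uu))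

⇉ᵢ-subst : ∀ j {M M' U U'} → Value U → M ⇉ᵢ M' → U ⇉ U' → subst j U M ⇉ᵢ subst j U' M'
⇉ᵢ-subst j u (ivar x) uu with ℕ.compare x j
... | ℕ.less _ _    = ivar _
... | ℕ.equal _     = value-⇉ᵢ u uu
... | ℕ.greater _ _ = ivar _
⇉ᵢ-subst j u (ilam m)   uu = ilam (⇉-subst (suc j) (value-shift 0 u) m (⇉-shift 0 uu))
⇉ᵢ-subst j u (iapp m n) uu = iapp (⇉ᵢ-subst j u m uu) (⇉ᵢ-subst j u n uu)
⇉ᵢ-subst j u (ior m n)  uu = ior (⇉-subst j u m uu) (⇉-subst j u n uu)

→w-subst : ∀ j {U M M'} → Value U → M →w M' → subst j U M →w subst j U M'
→w-subst j {U} u (wβ {M} {V} v) =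
  ≡-subst (subst j U (lam M · V) →w_) (sym (subst-β j U M V)) (wβ (value-subst j u v))
→w-subst j u (wL s) = wL (→w-subst j u s)
→w-subst j u (wR s) = wR (→w-subst j u s)

⇉-factorise : ∀ {M N} → M ⇉ N → ∃[ L ] (Star _→w_ M L × L ⇉ᵢ N)
⇉-factorise (pvar x)  = var x , ε , ivar x
⇉-factorise (plam m)  = _ , ε , ilam m
⇉-factorise (por m n) = _ , ε , ior m n
⇉-factorise (papp {N = N} m n) with ⇉-factorise m | ⇉-factorise n
... | L₁ , s₁ , i₁ | L₂ , s₂ , i₂ =
  L₁ · L₂ , gmap (_· N) wL s₁ ◅◅ gmap (L₁ ·_) wR s₂ , iapp i₁ i₂
⇉-factorise (pβ {V = V} v m u) with ⇉-factorise m
... | _ , s , i = _ , wβ v ◅ gmap (subst 0 V) (→w-subst 0 v) s , ⇉ᵢ-subst 0 v i u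

infixr 9 _∘ᶜ_

_∘ᶜ_ : Ctx → Ctx → Ctx
hole     ∘ᶜ C = C
appL D M ∘ᶜ C = appL (D ∘ᶜ C) M
appR M D ∘ᶜ C = appR M (D ∘ᶜ C)
lamC D   ∘ᶜ C = lamC (D ∘ᶜ C)
orL D M  ∘ᶜ C = orL (D ∘ᶜ C) M
orR M D  ∘ᶜ C = orR M (D ∘ᶜ C)

plug-∘ᶜ : ∀ D C X → plug (D ∘ᶜ C) X ≡ plug D (plug C X)
plug-∘ᶜ hole       C X = refl
plug-∘ᶜ (appL D M) C X = cong (_· M) (plug-∘ᶜ D C X)
plug-∘ᶜ (appR M D) C X = cong (M ·_) (plug-∘ᶜ D C X)
plug-∘ᶜ (lamC D)   C X = cong lam (plug-∘ᶜ D C X)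
plug-∘ᶜ (orL D M)  C X = cong (_⊕ M) (plug-∘ᶜ D C X)
plug-∘ᶜ (orR M D)  C X = cong (M ⊕_) (plug-∘ᶜ D C X)

weak-∘ᶜ⁻ : ∀ D {C} → Weak (D ∘ᶜ C) → Weak D × Weak C
weak-∘ᶜ⁻ hole       w          = hole , w
weak-∘ᶜ⁻ (appL D M) (appL _ w) = let wD , wC = weak-∘ᶜ⁻ D w in appL M wD , wC
weak-∘ᶜ⁻ (appR M D) (appR _ w) = let wD , wC = weak-∘ᶜ⁻ D w in appR M wD , wC

weak? : ∀ C → Dec (Weak C)
weak? hole       = yes hole
weak? (appL C M) = map′ (appL M) (λ { (appL _ w) → w }) (weak? C)
weak? (appR M C) = map′ (appR M) (λ { (appR _ w) → w }) (weak? C)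
weak? (lamC C)   = no λ ()
weak? (orL C M)  = no λ ()
weak? (orR M C)  = no λ ()

plug-⇉ : ∀ C {R R'} → R ⇉ R' → plug C R ⇉ plug C R'
plug-⇉ hole       r = r
plug-⇉ (appL C M) r = papp (plug-⇉ C r) (⇉-refl M)
plug-⇉ (appR M C) r = papp (⇉-refl M) (plug-⇉ C r)
plug-⇉ (lamC C)   r = plam (plug-⇉ C r)
plug-⇉ (orL C M)  r = por (plug-⇉ C r) (⇉-refl M)
plug-⇉ (orR M C)  r = por (⇉-refl M) (plug-⇉ C r)

plug-⇉ᵢ : ∀ C {R R'} → ¬ Weak C → R ⇉ R' → plug C R ⇉ᵢ plug C R'
plug-⇉ᵢ hole       ¬w r = contradiction hole ¬w
plug-⇉ᵢ (appL C M) ¬w r = iapp (plug-⇉ᵢ C (¬w ∘ appL M) r) (⇉ᵢ-refl M)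
plug-⇉ᵢ (appR M C) ¬w r = iapp (⇉ᵢ-refl M) (plug-⇉ᵢ C (¬w ∘ appR M) r)
plug-⇉ᵢ (lamC C)   ¬w r = ilam (plug-⇉ C r)
plug-⇉ᵢ (orL C M)  ¬w r = ior (plug-⇉ C r) (⇉-refl M)
plug-⇉ᵢ (orR M C)  ¬w r = ior (⇉-refl M) (plug-⇉ C r)

record WeakDecomposition (M : Tm) (S : Ctx) (R : Tm) : Set where
  constructor decomposition
  field
    S'     : Ctx
    weak   : Weak S'
    R'     : Tm
    M≡     : M ≡ plug S' R'
    R'⇉ᵢR  : R' ⇉ᵢ R
    around : ∀ {X X'} → X ⇉ X' → plug S' X ⇉ plug S X'

decompose : ∀ {M S R} → Weak S → M ⇉ᵢ plug S R → WeakDecomposition M S R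
decompose {M} hole i = decomposition hole hole M refl i id
decompose (appL _ w) (iapp a b) with decompose w a
... | decomposition S' w' R' refl r around =
  decomposition (appL S' _) (appL _ w') R' refl r (λ x → papp (around x) (⇉ᵢ⇒⇉ b))
decompose (appR _ w) (iapp a b) with decompose w b
... | decomposition S' w' R' refl r around =
  decomposition (appR _ S') (appR _ w') R' refl r (λ x → papp (⇉ᵢ⇒⇉ a) (around x))

PointStep : StepRel → Tm → Tm → Set
PointStep r M N = r M ⟦ N ⟧

βv-plug : ∀ D {M N} → PointStep _→βv_ M N → PointStep _→βv_ (plug D M) (plug D N)
βv-plug D (βv C P V v) =
  ≡-subst₂ (PointStep _→βv_) (plug-∘ᶜ D C _) (plug-∘ᶜ D C _) (βv (D ∘ᶜ C) P V v)

βv-plug-¬weak : ∀ D {M N} → ¬ Weak D → PointStep _→βv_ M N → PointStep _→¬wβv_ (plug D M) (plug D N)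
βv-plug-¬weak D ¬wD (βv C P V v) =
  ≡-subst₂ (PointStep _→¬wβv_) (plug-∘ᶜ D C _) (plug-∘ᶜ D C _)
    (¬wβv (D ∘ᶜ C) (¬wD ∘ proj₁ ∘ weak-∘ᶜ⁻ D) P V v)

¬wβv-plug : ∀ D {M N} → PointStep _→¬wβv_ M N → PointStep _→¬wβv_ (plug D M) (plug D N)
¬wβv-plug D (¬wβv C ¬wC P V v) =
  ≡-subst₂ (PointStep _→¬wβv_) (plug-∘ᶜ D C _) (plug-∘ᶜ D C _)
    (¬wβv (D ∘ᶜ C) (¬wC ∘ proj₂ ∘ weak-∘ᶜ⁻ D) P V v)

⇉⇒βv* : ∀ {M N} → M ⇉ N → Star (PointStep _→βv_) M N
⇉⇒βv* (pvar x) = ε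
⇉⇒βv* (plam m) = gmap lam (βv-plug (lamC hole)) (⇉⇒βv* m)
⇉⇒βv* (papp {M' = M'} {N = N} m n) =
  gmap (_· N) (βv-plug (appL hole N)) (⇉⇒βv* m) ◅◅ gmap (M' ·_) (βv-plug (appR M' hole)) (⇉⇒βv* n)
⇉⇒βv* (por {M' = M'} {N = N} m n) =
  gmap (_⊕ N) (βv-plug (orL hole N)) (⇉⇒βv* m) ◅◅ gmap (M' ⊕_) (βv-plug (orR M' hole)) (⇉⇒βv* n)
⇉⇒βv* (pβ {M' = M'} {V = V} v m u) =
  gmap (λ T → lam T · V) (βv-plug (appL (lamC hole) V)) (⇉⇒βv* m)
  ◅◅ gmap (lam M' ·_) (βv-plug (appR (lam M') hole)) (⇉⇒βv* u)
  ◅◅ βv hole M' _ (value-⇉ v u) ◅ ε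

⇉ᵢ⇒¬wβv* : ∀ {M N} → M ⇉ᵢ N → Star (PointStep _→¬wβv_) M N
⇉ᵢ⇒¬wβv* (ivar x) = ε
⇉ᵢ⇒¬wβv* (ilam m) = gmap lam (βv-plug-¬weak (lamC hole) λ ()) (⇉⇒βv* m)
⇉ᵢ⇒¬wβv* (iapp {M' = M'} {N = N} m n) =
  gmap (_· N) (¬wβv-plug (appL hole N)) (⇉ᵢ⇒¬wβv* m) ◅◅ gmap (M' ·_) (¬wβv-plug (appR M' hole)) (⇉ᵢ⇒¬wβv* n)
⇉ᵢ⇒¬wβv* (ior {M' = M'} {N = N} m n) =
  gmap (_⊕ N) (βv-plug-¬weak (orL hole N) λ ()) (⇉⇒βv* m) ◅◅ gmap (M' ⊕_) (βv-plug-¬weak (orR M' hole) λ ()) (⇉⇒βv* n)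

→w⇒wβv : ∀ {M N} → M →w N → PointStep _→wβv_ M N
→w⇒wβv (wβ {M} {V} v) = wβv hole hole M V v
→w⇒wβv (wL {N = N} s) with →w⇒wβv s
... | wβv C w P V v = wβv (appL C N) (appL N w) P V v
→w⇒wβv (wR {M = M} s) with →w⇒wβv s
... | wβv C w P V v = wβv (appR M C) (appR M w) P V v

∙-identityˡ : ∀ m → 1ℚ ∙ m ≡ m
∙-identityˡ []            = refl
∙-identityˡ ((p , M) ∷ m) = cong₂ _∷_ (cong (_, M) (ℚ.*-identityˡ p)) (∙-identityˡ m)

∙-point : ∀ p M → p ∙ ⟦ M ⟧ ≡ (p , M) ∷ []
∙-point p M = cong (λ q → (q , M) ∷ []) (ℚ.*-identityʳ p)

∙-∙ : ∀ q p m → q ∙ (p ∙ m) ≡ (q ℚ.* p) ∙ m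
∙-∙ q p []            = refl
∙-∙ q p ((r , M) ∷ m) = cong₂ _∷_ (cong (_, M) (sym (ℚ.*-assoc q p r))) (∙-∙ q p m)

∙-++ : ∀ q a b → q ∙ (a ++ b) ≡ q ∙ a ++ q ∙ b
∙-++ q a b = map-++ _ a b

1∙-++[] : ∀ m → 1ℚ ∙ m ++ [] ≡ m
1∙-++[] m = trans (++-identityʳ _) (∙-identityˡ m)

-- A normal form for the inductive lifting LiftL: a list [pᵢMᵢ] is related to
-- Σᵢ pᵢ·mᵢ where each Mᵢ either stays ([Mᵢ] = mᵢ) or makes an r-step to mᵢ.
-- Up to permutation of the target, this is the lifted relation ⇛_r.

ReflStep : StepRel → Tm → MList → Set
ReflStep r M m = (m ≡ ⟦ M ⟧) ⊎ r M m

data LiftPw (r : StepRel) : MList → MList → Set where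
  []  : LiftPw r [] []
  _∷_ : ∀ {p M m ms ns} → ReflStep r M m → LiftPw r ms ns → LiftPw r ((p , M) ∷ ms) ((p ∙ m) ++ ns)

Lifted : StepRel → MList → MList → Set
Lifted r xs ys = ∃[ ys' ] (LiftPw r xs ys' × ys' ↭ ys)

mutual
  LiftL-point : ∀ {r M m} → LiftL r ⟦ M ⟧ m → ∃[ m' ] (ReflStep r M m' × m' ≡ m)
  LiftL-point (lrefl M)       = _ , inj₁ refl , refl
  LiftL-point (lstep s)       = _ , inj₂ s , refl
  LiftL-point (lsum (l ∷ [])) with LiftL-point l
  ... | m' , s , refl = m' , s , sym (1∙-++[] m')

  LiftL⇒LiftPw : ∀ {r xs ys} → LiftL r xs ys → ∃[ ys' ] (LiftPw r xs ys' × ys' ≡ ys)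
  LiftL⇒LiftPw (lrefl M) = _ , inj₁ refl ∷ [] , refl
  LiftL⇒LiftPw (lstep s) = _ , inj₂ s ∷ [] , 1∙-++[] _
  LiftL⇒LiftPw (lsum ls) = LiftAll⇒LiftPw ls

  LiftAll⇒LiftPw : ∀ {r xs ys} → LiftAll r xs ys → ∃[ ys' ] (LiftPw r xs ys' × ys' ≡ ys)
  LiftAll⇒LiftPw []       = [] , [] , refl
  LiftAll⇒LiftPw (l ∷ ls) with LiftL-point l | LiftAll⇒LiftPw ls
  ... | _ , s , refl | _ , ss , refl = _ , s ∷ ss , refl

LiftPw⇒LiftAll : ∀ {r xs ys} → LiftPw r xs ys → LiftAll r xs ys
LiftPw⇒LiftAll []               = []
LiftPw⇒LiftAll (inj₁ refl ∷ ss) = lrefl _ ∷ LiftPw⇒LiftAll ss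
LiftPw⇒LiftAll (inj₂ s ∷ ss)    = lstep s ∷ LiftPw⇒LiftAll ss

fromLift : ∀ {r} (m n : MD) → Lift r m n → Lifted r (proj₁ m) (proj₁ n)
fromLift _ _ (ys , l , p) with LiftL⇒LiftPw l
... | ys' , ss , refl = ys' , ss , p

toLift : ∀ {r} (m n : MD) → Lifted r (proj₁ m) (proj₁ n) → Lift r m n
toLift _ _ (ys , ss , p) = ys , lsum (LiftPw⇒LiftAll ss) , p

LiftPw-refl : ∀ {r} xs → ∃[ ys ] (LiftPw r xs ys × ys ≡ xs)
LiftPw-refl []             = [] , [] , refl
LiftPw-refl ((p , M) ∷ xs) with LiftPw-refl xs
... | ys , ss , ys≡xs = _ , inj₁ refl ∷ ss , cong₂ _++_ (∙-point p M) ys≡xs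

LiftPw-++ : ∀ {r a b c d} → LiftPw r a b → LiftPw r c d → LiftPw r (a ++ c) (b ++ d)
LiftPw-++ []       ts = ts
LiftPw-++ {r} {d = d} (_∷_ {p = p} {m = m} {ns = ns} s ss) ts =
  ≡-subst (LiftPw r _) (sym (++-assoc (p ∙ m) ns d)) (s ∷ LiftPw-++ ss ts)

LiftPw-scale : ∀ {r xs ys} q → LiftPw r xs ys → LiftPw r (q ∙ xs) (q ∙ ys)
LiftPw-scale q [] = []
LiftPw-scale {r} q (_∷_ {p = p} {m = m} {ns = ns} s ss) =
  ≡-subst (LiftPw r _) (sym (trans (∙-++ q (p ∙ m) ns) (cong (_++ q ∙ ns) (∙-∙ q p m))))
    (s ∷ LiftPw-scale q ss)

LiftPw-perm : ∀ {r xs xs' ys} → xs ↭ xs' → LiftPw r xs ys → ∃[ ys' ] (LiftPw r xs' ys' × ys ↭ ys')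
LiftPw-perm ↭.refl ss = _ , ss , ↭-refl
LiftPw-perm (↭.prep _ π) (_∷_ {p = q} {m = m} s ss) with LiftPw-perm π ss
... | _ , ss' , π' = _ , s ∷ ss' , ++⁺ˡ (q ∙ m) π'
LiftPw-perm (↭.swap _ _ π) (_∷_ {p = q₁} {m = m₁} s₁ (_∷_ {p = q₂} {m = m₂} s₂ ss)) with LiftPw-perm π ss
... | _ , ss' , π' = _ , s₂ ∷ s₁ ∷ ss' ,
  ↭-trans (++⁺ˡ (q₁ ∙ m₁) (++⁺ˡ (q₂ ∙ m₂) π')) (shifts (q₁ ∙ m₁) (q₂ ∙ m₂))
LiftPw-perm (↭.trans π₁ π₂) ss with LiftPw-perm π₁ ss
... | _ , ss₁ , π₁' with LiftPw-perm π₂ ss₁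
... | _ , ss₂ , π₂' = _ , ss₂ , ↭-trans π₁' π₂'

Lifted-perm : ∀ {r xs ys} → xs ↭ ys → Lifted r xs ys
Lifted-perm {xs = xs} π with LiftPw-refl xs
... | ys , ss , ys≡xs = ys , ss , ↭-trans (↭-reflexive ys≡xs) π

Lifted-++ : ∀ {r a b c d} → Lifted r a b → Lifted r c d → Lifted r (a ++ c) (b ++ d)
Lifted-++ (_ , ss , π) (_ , ts , ρ) = _ , LiftPw-++ ss ts , ++⁺ π ρ

Lifted-scale : ∀ {r xs ys} q → Lifted r xs ys → Lifted r (q ∙ xs) (q ∙ ys)
Lifted-scale q (ys' , ss , π) = q ∙ ys' , LiftPw-scale q ss , map⁺ _ π

Lifted-frameˡ : ∀ {r xs ys} zs → Lifted r xs ys → Lifted r (zs ++ xs) (zs ++ ys)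
Lifted-frameˡ zs = Lifted-++ (Lifted-perm ↭-refl)

Lifted-frameʳ : ∀ {r xs ys} zs → Lifted r xs ys → Lifted r (xs ++ zs) (ys ++ zs)
Lifted-frameʳ zs s = Lifted-++ s (Lifted-perm ↭-refl)

Lifted-point : ∀ {r M m} → r M m → Lifted r ⟦ M ⟧ m
Lifted-point s = _ , inj₂ s ∷ [] , ↭-reflexive (1∙-++[] _)

module StarFrames (R : MList → MList → Set)
  (frameˡ : ∀ {xs ys} zs → R xs ys → R (zs ++ xs) (zs ++ ys))
  (frameʳ : ∀ {xs ys} zs → R xs ys → R (xs ++ zs) (ys ++ zs))
  (scale  : ∀ {xs ys} q → R xs ys → R (q ∙ xs) (q ∙ ys)) where

  *-scale : ∀ {xs ys} q → Star R xs ys → Star R (q ∙ xs) (q ∙ ys)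
  *-scale q = gmap (q ∙_) (scale q)

  *-++ : ∀ {xs xs' zs zs'} → Star R xs xs' → Star R zs zs' → Star R (xs ++ zs) (xs' ++ zs')
  *-++ {xs' = xs'} {zs = zs} s t = gmap (_++ zs) (frameʳ zs) s ◅◅ gmap (xs' ++_) (frameˡ xs') t

  *-∷ : ∀ {p M a xs as} → Star R ⟦ M ⟧ a → Star R xs as → Star R ((p , M) ∷ xs) (p ∙ a ++ as)
  *-∷ {p} {M} {a} {xs} {as} s t = ≡-subst (λ z → Star R (z ++ xs) (p ∙ a ++ as)) (∙-point p M) (*-++ (*-scale p s) t)

  *-point : ∀ {p M N} → Star R ⟦ M ⟧ ⟦ N ⟧ → Star R ((p , M) ∷ []) ((p , N) ∷ [])
  *-point {p} {M} {N} s = ≡-subst₂ (Star R) (∙-point p M) (∙-point p N) (*-scale p s)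

WeakStep : MList → MList → Set
WeakStep xs ys = Lifted _→wβv_ xs ys ⊎ Lifted _→⊕_ xs ys

WeakStep-frameˡ : ∀ {xs ys} zs → WeakStep xs ys → WeakStep (zs ++ xs) (zs ++ ys)
WeakStep-frameˡ zs = Sum.map (Lifted-frameˡ zs) (Lifted-frameˡ zs)

WeakStep-frameʳ : ∀ {xs ys} zs → WeakStep xs ys → WeakStep (xs ++ zs) (ys ++ zs)
WeakStep-frameʳ zs = Sum.map (Lifted-frameʳ zs) (Lifted-frameʳ zs)

WeakStep-scale : ∀ {xs ys} q → WeakStep xs ys → WeakStep (q ∙ xs) (q ∙ ys)
WeakStep-scale q = Sum.map (Lifted-scale q) (Lifted-scale q)

module Weak* = StarFrames WeakStep WeakStep-frameˡ WeakStep-frameʳ WeakStep-scale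

weak*-point : ∀ {M N} → Star _→w_ M N → Star WeakStep ⟦ M ⟧ ⟦ N ⟧
weak*-point = gmap ⟦_⟧ (inj₁ ∘ Lifted-point ∘ →w⇒wβv)

_≈⇉ᵢ_ : ℚ × Tm → ℚ × Tm → Set
(p , M) ≈⇉ᵢ (q , N) = p ≡ q × M ⇉ᵢ N

Internal : MList → MList → Set
Internal xs ys = ∃[ zs ] (Pointwise _≈⇉ᵢ_ xs zs × zs ↭ ys)

Internal-point : ∀ {M N} → M ⇉ᵢ N → Internal ⟦ M ⟧ ⟦ N ⟧
Internal-point i = _ , (refl , i) ∷ [] , ↭-refl

Internal-++ : ∀ {a b c d} → Internal a b → Internal c d → Internal (a ++ c) (b ++ d)
Internal-++ (_ , is , π) (_ , js , ρ) = _ , PW.++⁺ is js , ++⁺ π ρ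

Internal-scale : ∀ {a b} q → Internal a b → Internal (q ∙ a) (q ∙ b)
Internal-scale q (_ , is , π) =
  _ , PW.map⁺ _ _ (PW.map (λ { (p≡p' , i) → cong (q ℚ.*_) p≡p' , i }) is) , map⁺ _ π

Postponable : StepRel → Set
Postponable r = ∀ {M N c} → M ⇉ᵢ N → r N c → ∃[ a ] (Star WeakStep ⟦ M ⟧ a × Internal a c)

-- A weak redex in the internal reduct of M already is a weak redex of M,
-- with a value argument (internal reduction reflects values).  Contracting
-- it first leaves a parallel step, which factorises.
postponable-wβv : Postponable _→wβv_
postponable-wβv i (wβv C w P V v) with decompose w i
... | decomposition S' w' _ refl (iapp {M' = lam P} {N = B} (ilam {M = P'} P'⇉P) B⇉ᵢV) around
  with ⇉-factorise (around (⇉-subst 0 (value-⇉ᵢ⁻ v B⇉ᵢV) P'⇉P (⇉ᵢ⇒⇉ B⇉ᵢV)))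
... | L , s , L⇉ᵢ =
  ⟦ L ⟧ , inj₁ (Lifted-point (wβv S' w' P' B (value-⇉ᵢ⁻ v B⇉ᵢV))) ◅ weak*-point s , Internal-point L⇉ᵢ

-- Likewise a weak choice in the internal reduct already is one in M.
postponable-⊕ : Postponable _→⊕_
postponable-⊕ i (⊕s S w A B) with decompose w i
... | decomposition S' w' _ refl (ior {M = A'} {N = B'} A'⇉A B'⇉B) around
  with ⇉-factorise (around A'⇉A) | ⇉-factorise (around B'⇉B)
... | L₁ , s₁ , i₁ | L₂ , s₂ , i₂ =
  (½ , L₁) ∷ (½ , L₂) ∷ [] ,
  inj₂ (Lifted-point (⊕s S' w' A' B'))
    ◅ Weak*.*-++ (Weak*.*-point (weak*-point s₁)) (Weak*.*-point (weak*-point s₂)) ,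
  _ , (refl , i₁) ∷ (refl , i₂) ∷ [] , ↭-refl

postpone-ReflStep : ∀ {r} → Postponable r → ∀ {M N c} → M ⇉ᵢ N → ReflStep r N c →
                    ∃[ a ] (Star WeakStep ⟦ M ⟧ a × Internal a c)
postpone-ReflStep post {M} i (inj₁ refl) = ⟦ M ⟧ , ε , Internal-point i
postpone-ReflStep post     i (inj₂ s)    = post i s

postpone-LiftPw : ∀ {r} → Postponable r → ∀ {xs ys zs} → Pointwise _≈⇉ᵢ_ xs ys → LiftPw r ys zs →
                  ∃[ as ] (Star WeakStep xs as × Internal as zs)
postpone-LiftPw post []                []       = [] , ε , _ , [] , ↭-refl
postpone-LiftPw post ((refl , i) ∷ is) (_∷_ {p = p} s ss)
  with postpone-ReflStep post i s | postpone-LiftPw post is ss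
... | a , w , j | as , ws , js = p ∙ a ++ as , Weak*.*-∷ w ws , Internal-++ (Internal-scale p j) js

postpone-Lifted : ∀ {r} → Postponable r → ∀ {xs ys zs} → Internal xs ys → Lifted r ys zs →
                  ∃[ as ] (Star WeakStep xs as × Internal as zs)
postpone-Lifted post (_ , is , π) (_ , ss , ρ) with LiftPw-perm (↭-sym π) ss
... | _ , ss' , ρ' with postpone-LiftPw post is ss'
... | as , ws , (_ , js , σ) = as , ws , _ , js , ↭-trans σ (↭-trans (↭-sym ρ') ρ)

postpone-weak : ∀ {xs ys zs} → Internal xs ys → WeakStep ys zs →
                ∃[ as ] (Star WeakStep xs as × Internal as zs)
postpone-weak j = [ postpone-Lifted postponable-wβv j , postpone-Lifted postponable-⊕ j ]′

postpone-weak* : ∀ {xs ys zs} → Internal xs ys → Star WeakStep ys zs →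
                 ∃[ as ] (Star WeakStep xs as × Internal as zs)
postpone-weak* j ε = _ , ε , j
postpone-weak* j (s ◅ ss) with postpone-weak j s
... | _ , ws₁ , j₁ with postpone-weak* j₁ ss
... | as , ws₂ , j₂ = as , ws₁ ◅◅ ws₂ , j₂

-- A βv step splits into a weak βv step followed by an internal step: a
-- redex in non-weak position is contracted by an internal step.
βv-split-term : ∀ {M m} → ReflStep _→βv_ M m →
                ∃[ N ] ∃[ N' ] (m ≡ ⟦ N' ⟧ × ReflStep _→wβv_ M ⟦ N ⟧ × N ⇉ᵢ N')
βv-split-term (inj₁ refl) = _ , _ , refl , inj₁ refl , ⇉ᵢ-refl _
βv-split-term (inj₂ (βv C P V v)) with weak? C
... | yes w  = _ , _ , refl , inj₂ (wβv C w P V v) , ⇉ᵢ-refl _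
... | no ¬w = _ , _ , refl , inj₁ refl , plug-⇉ᵢ C ¬w (pβ v (⇉-refl P) (⇉-refl V))

βv-split-LiftPw : ∀ {xs ys} → LiftPw _→βv_ xs ys → ∃[ zs ] (LiftPw _→wβv_ xs zs × Pointwise _≈⇉ᵢ_ zs ys)
βv-split-LiftPw []       = [] , [] , []
βv-split-LiftPw (s ∷ ss) with βv-split-term s | βv-split-LiftPw ss
... | _ , _ , refl , t , i | _ , ts , is = _ , t ∷ ts , (refl , i) ∷ is

βv-split : ∀ {xs ys} → Lifted _→βv_ xs ys → ∃[ zs ] (WeakStep xs zs × Internal zs ys)
βv-split (_ , ss , π) =
  let zs , ts , is = βv-split-LiftPw ss in zs , inj₁ (zs , ts , ↭-refl) , _ , is , π

weak-factorisation : ∀ {xs ys} → Star (Lifted _→βv_ ∪ Lifted _→⊕_) xs ys →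
                     ∃[ zs ] (Star WeakStep xs zs × Star Internal zs ys)
weak-factorisation ε = _ , ε , ε
weak-factorisation (inj₂ s ◅ ss) with weak-factorisation ss
... | zs , ws , js = zs , inj₂ s ◅ ws , js
weak-factorisation (inj₁ s ◅ ss) with weak-factorisation ss | βv-split s
... | _ , ws , js | _ , w , j with postpone-weak* j ws
... | zs , ws' , j' = zs , w ◅ ws' , j' ◅ js

NonWeakStep : MList → MList → Set
NonWeakStep = Lifted _→¬wβv_

module NonWeak* = StarFrames NonWeakStep Lifted-frameˡ Lifted-frameʳ Lifted-scale

Internal⇒nonweak* : ∀ {xs ys} → Internal xs ys → Star NonWeakStep xs ys
Internal⇒nonweak* (_ , is , π) = entrywise is ◅◅ Lifted-perm π ◅ ε
  where
  entrywise : ∀ {xs ys} → Pointwise _≈⇉ᵢ_ xs ys → Star NonWeakStep xs ys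
  entrywise []                = ε
  entrywise ((refl , i) ∷ is) =
    NonWeak*.*-++ (NonWeak*.*-point (gmap ⟦_⟧ Lifted-point (⇉ᵢ⇒¬wβv* i))) (entrywise is)

Weight : ℚ → Set
Weight p = 0ℚ ℚ.< p × p ℚ.≤ 1ℚ

mass : MList → ℚ
mass xs = sumℚ (map proj₁ xs)

Proper : MList → Set
Proper m = All (Weight ∘ proj₁) m × mass m ≡ 1ℚ

mass-++ : ∀ a b → mass (a ++ b) ≡ mass a ℚ.+ mass b
mass-++ []            b = sym (ℚ.+-identityˡ _)
mass-++ ((p , M) ∷ a) b = trans (cong (p ℚ.+_) (mass-++ a b)) (sym (ℚ.+-assoc p (mass a) (mass b)))

mass-∙ : ∀ p m → mass (p ∙ m) ≡ p ℚ.* mass m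
mass-∙ p []            = sym (ℚ.*-zeroʳ p)
mass-∙ p ((q , M) ∷ m) = trans (cong (p ℚ.* q ℚ.+_) (mass-∙ p m)) (sym (ℚ.*-distribˡ-+ p q (mass m)))

mass-↭ : ∀ {a b} → a ↭ b → mass a ≡ mass b
mass-↭ π = foldr-commMonoid ℚ+.setoid ℚ+.isCommutativeMonoid (↭⇒↭ₛ (map⁺ proj₁ π))
  where module ℚ+ = CommutativeMonoid ℚ.+-0-commutativeMonoid

weight-* : ∀ {p q} → Weight p → Weight q → Weight (p ℚ.* q)
weight-* {p} {q} (0<p , p≤1) (0<q , q≤1) =
  ℚ.positive⁻¹ (p ℚ.* q) {{ℚ.pos*pos⇒pos p {{ℚ.positive 0<p}} q {{ℚ.positive 0<q}}}} ,
  ℚ.≤-trans (ℚ.*-monoˡ-≤-nonNeg p {{ℚ.pos⇒nonNeg p {{ℚ.positive 0<p}}}} q≤1)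
            (ℚ.≤-trans (ℚ.≤-reflexive (ℚ.*-identityʳ p)) p≤1)

weights-∙ : ∀ {p} m → Weight p → All (Weight ∘ proj₁) m → All (Weight ∘ proj₁) (p ∙ m)
weights-∙ []      wp []         = []
weights-∙ (_ ∷ m) wp (wq ∷ ws) = weight-* wp wq ∷ weights-∙ m wp ws

proper-point : ∀ M → Proper ⟦ M ⟧
proper-point M = (ℚ.positive⁻¹ 1ℚ , ℚ.≤-refl) ∷ [] , ℚ.+-identityʳ 1ℚ

LiftPw-mass : ∀ {r} → (∀ {M m} → r M m → Proper m) → ∀ {xs ys} → LiftPw r xs ys →
              All (Weight ∘ proj₁) xs → All (Weight ∘ proj₁) ys × mass ys ≡ mass xs
LiftPw-mass proper [] [] = [] , refl
LiftPw-mass proper (_∷_ {p = p} {M} {m} {ms} {ns} s ss) (wp ∷ ws)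
  with [ (λ { refl → proper-point M }) , proper ]′ s | LiftPw-mass proper ss ws
... | wsₘ , massₘ≡1 | ws' , mass≡ = ++⁺ᴬ (weights-∙ m wp wsₘ) ws' , (begin
  mass (p ∙ m ++ ns)       ≡⟨ mass-++ (p ∙ m) ns ⟩
  mass (p ∙ m) ℚ.+ mass ns ≡⟨ cong₂ ℚ._+_ (mass-∙ p m) mass≡ ⟩
  p ℚ.* mass m ℚ.+ mass ms ≡⟨ cong (λ t → p ℚ.* t ℚ.+ mass ms) massₘ≡1 ⟩
  p ℚ.* 1ℚ ℚ.+ mass ms     ≡⟨ cong (ℚ._+ mass ms) (ℚ.*-identityʳ p) ⟩
  p ℚ.+ mass ms            ∎)

Lifted-IsMD : ∀ {r} → (∀ {M m} → r M m → Proper m) → ∀ {xs ys} → IsMD xs → Lifted r xs ys → IsMD ys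
Lifted-IsMD proper (ws , mass≤1) (_ , ss , π) with LiftPw-mass proper ss ws
... | ws' , mass≡ = All-resp-↭ π ws' , ≡-subst (ℚ._≤ 1ℚ) (trans (sym mass≡) (mass-↭ π)) mass≤1

proper-wβv : ∀ {M m} → M →wβv m → Proper m
proper-wβv (wβv _ _ _ _ _) = proper-point _

proper-¬wβv : ∀ {M m} → M →¬wβv m → Proper m
proper-¬wβv (¬wβv _ _ _ _ _) = proper-point _

proper-⊕ : ∀ {M m} → M →⊕ m → Proper m
proper-⊕ (⊕s _ _ _ _) = weight-½ ∷ weight-½ ∷ [] , refl
  where
  weight-½ : Weight ½
  weight-½ = ℚ.positive⁻¹ ½ , toWitness {a? = ½ ℚ.≤? 1ℚ} _

module _ {R : MList → MList → Set} {S : MD → MD → Set}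
         (preserves : ∀ {xs ys} → IsMD xs → R xs ys → IsMD ys)
         (toMD : ∀ (m n : MD) → R (proj₁ m) (proj₁ n) → S m n) where

  Star-MD : ∀ (m : MD) {ys} → Star R (proj₁ m) ys → ∃[ isMD ] Star S m (ys , isMD)
  Star-MD m ε = proj₂ m , ε
  Star-MD m (_◅_ {j = ys'} s ss) =
    let m' = ys' , preserves (proj₂ m) s
        isMD , steps = Star-MD m' ss
    in  isMD , toMD m m' s ◅ steps

WeakStep-IsMD : ∀ {xs ys} → IsMD xs → WeakStep xs ys → IsMD ys
WeakStep-IsMD isMD = [ Lifted-IsMD proper-wβv isMD , Lifted-IsMD proper-⊕ isMD ]′

WeakStep⇒⇛w : ∀ (m n : MD) → WeakStep (proj₁ m) (proj₁ n) → ⇛w m n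
WeakStep⇒⇛w m n = Sum.map (toLift m n) (toLift m n)

-- The factorisation is computed on lists and
-- transported back; as the final multi-distribution is reached with a
-- possibly different validity proof, an identity step bridges to n.
theoremB2 : ∀ (m n : MD) → Star (⇛βv ∪ ⇛⊕) m n →
            ∃[ k ] (Star ⇛w m k × Star ⇛¬w k n)
theoremB2 m n steps =
  let on-lists             = gmap proj₁ (λ {m} {n} → Sum.map (fromLift m n) (fromLift m n)) steps
      zs , weak , internal = weak-factorisation on-lists
      isMDₖ , weak-MD      = Star-MD WeakStep-IsMD WeakStep⇒⇛w m weak
      nonweak              = (Internal⇒nonweak* ⋆) internal
      isMDₙ , nonweak-MD   = Star-MD (Lifted-IsMD proper-¬wβv) toLift (zs , isMDₖ) nonweak
  in  (zs , isMDₖ) , weak-MD , nonweak-MD ◅◅ toLift (proj₁ n , isMDₙ) n (Lifted-perm ↭-refl) ◅ ε
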